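{- Let $\mathcal Q\in\{\mathcal Q_p[\Diamond],\mathcal Q_p[\bigcirc,\Diamond],\mathcal Q[\Diamond],\mathcal Q[\bigcirc,\Diamond]\}$. Then $\mathcal Q$ has the polynomial separation property under the empty ontology: there is a polynomial $p$ such that every $\mathcal Q$-separable example set $E$ is separated by some $\varkappa\in\mathcal Q$ with $|\varkappa|\le p(|E|)$.
   Context: Strict semantics over $\mathbb N$: $\mathcal I,n\models\bigcirc\varphi$ iff $\mathcal I,n+1\models\varphi$; $\mathcal I,n\models\Diamond\varphi$ iff $\mathcal I,m\models\varphi$ for some $m>n$. A data instance $\mathcal D$ is a finite set of facts $A(\ell)$, $\ell\in\mathbb N$; $\mathcal D\models\varkappa(0)$ means $\mathcal I,0\models\varkappa$ in every interpretation $\mathcal I$ in which all facts of $\mathcal D$ hold. $\mathcal Q[\Diamond]$ ($\mathcal Q[\bigcirc,\Diamond]$): queries built from atoms, $\top,\bot$ using $\wedge$ and $\Diamond$ (and $\bigcirc$). $\mathcal Q_p[\bigcirc,\Diamond]$: queries $\rho_0\wedge o_1(\rho_1\wedge o_2(\dots\wedge o_n\rho_n))$ with $o_i\in\{\bigcirc,\Diamond\}$ and $\rho_i$ (possibly empty) conjunctions of atoms; $\mathcal Q_p[\Diamond]$: all $o_i=\Diamond$. An example set $E=(E^+,E^-)$ of finite sets of data instances is separated by $\varkappa$ if $\mathcal D\models\varkappa(0)$ for all $\mathcal D\in E^+$ and $\mathcal D\not\models\varkappa(0)$ for all $\mathcal D\in E^-$; it is $\mathcal Q$-separable if some $\varkappa\in\mathcal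 Q$ separates it. Sizes are numbers of symbols, timestamps in unary. -}

module Defs where

open import Data.Nat using (ℕ; zero; suc; _+_; _*_; _<_; _≤_)
open import Data.Bool using (Bool; true)
open import Data.List using (List; []; _∷_)
open import Data.List.Membership.Propositional using (_∈_)
open import Data.Product using (_×_; _,_; Σ; ∃)
open import Data.Unit using (⊤)
open import Data.Empty using (⊥)
open import Relation.Binary.PropositionalEquality using (_≡_)
open import Relation.Nullary using (¬_)

Atom : Set
Atom = ℕ

infixr 6 _∧q_
data Query : Set where
  atom : Atom → Query
  ⊤q   : Query
  ⊥q   : Query
  _∧q_ : Query → Query → Query
  ○q   : Query → Query
  ◇q   : Query → Query

size : Query → ℕ
size (atom A)  = 1
size ⊤q        = 1
size ⊥q        = 1
size (φ ∧q ψ)  = suc (size φ + size ψ)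
size (○q φ)    = suc (size φ)
size (◇q φ)    = suc (size φ)

Interp : Set
Interp = Atom → ℕ → Bool

_,_⊨_ : Interp → ℕ → Query → Set
I , n ⊨ atom A   = I A n ≡ true
I , n ⊨ ⊤q       = ⊤
I , n ⊨ ⊥q       = ⊥
I , n ⊨ (φ ∧q ψ) = (I , n ⊨ φ) × (I , n ⊨ ψ)
I , n ⊨ ○q φ     = I , suc n ⊨ φ
I , n ⊨ ◇q φ     = Σ ℕ λ m → (n < m) × (I , m ⊨ φ)

-- Data instances: finite sets of facts A(ℓ), given as lists of pairs (A , ℓ).
Fact : Set
Fact = Atom × ℕ

DataInstance : Set
DataInstance = List Fact

_Models_ : Interp → DataInstance → Set
I Models D = ∀ A ℓ → (A , ℓ) ∈ D → I A ℓ ≡ true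

-- D ⊨ κ(0): κ holds at 0 in every interpretation satisfying D (empty ontology).
_⊨₀_ : DataInstance → Query → Set
D ⊨₀ κ = ∀ (I : Interp) → I Models D → I , 0 ⊨ κ

-- Sizes: a fact A(ℓ) has size 1 + (ℓ + 1) (timestamps in unary).
factSize : Fact → ℕ
factSize (A , ℓ) = suc (suc ℓ)

instSize : DataInstance → ℕ
instSize []      = 0
instSize (f ∷ D) = factSize f + instSize D

instsSize : List DataInstance → ℕ
instsSize []      = 0
instsSize (D ∷ Ds) = suc (instSize D + instsSize Ds)

record ExampleSet : Set where
  constructor ⟨_,_⟩
  field
    pos : List DataInstance
    neg : List DataInstance
open ExampleSet public

exSize : ExampleSet → ℕ
exSize E = instsSize (pos E) + instsSize (neg E)

Separates : Query → ExampleSet → Set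
Separates κ E =
  (∀ D → D ∈ pos E → D ⊨₀ κ) × (∀ D → D ∈ neg E → ¬ (D ⊨₀ κ))

data IsConjAtoms : Query → Set where
  c-⊤    : IsConjAtoms ⊤q
  c-atom : ∀ A → IsConjAtoms (atom A)
  c-∧    : ∀ {φ ψ} → IsConjAtoms φ → IsConjAtoms ψ → IsConjAtoms (φ ∧q ψ)

-- Q_p[○,◇]: ρ₀ ∧ o₁(ρ₁ ∧ o₂(… ∧ oₙ ρₙ)).
data IsPathNextDia : Query → Set where
  p-end : ∀ {ρ} → IsConjAtoms ρ → IsPathNextDia ρ
  p-○   : ∀ {ρ q} → IsConjAtoms ρ → IsPathNextDia q → IsPathNextDia (ρ ∧q ○q q)
  p-◇   : ∀ {ρ q} → IsConjAtoms ρ → IsPathNextDia q → IsPathNextDia (ρ ∧q ◇q q)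

data IsPathDia : Query → Set where
  p-end : ∀ {ρ} → IsConjAtoms ρ → IsPathDia ρ
  p-◇   : ∀ {ρ q} → IsConjAtoms ρ → IsPathDia q → IsPathDia (ρ ∧q ◇q q)

data NoNext : Query → Set where
  n-atom : ∀ A → NoNext (atom A)
  n-⊤    : NoNext ⊤q
  n-⊥    : NoNext ⊥q
  n-∧    : ∀ {φ ψ} → NoNext φ → NoNext ψ → NoNext (φ ∧q ψ)
  n-◇    : ∀ {φ} → NoNext φ → NoNext (◇q φ)

data QClass : Set where
  Qp-◇ Qp-○◇ Q-◇ Q-○◇ : QClass

_∈Q_ : Query → QClass → Set
κ ∈Q Qp-◇  = IsPathDia κ
κ ∈Q Qp-○◇ = IsPathNextDia κ
κ ∈Q Q-◇   = NoNext κ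
κ ∈Q Q-○◇  = ⊤

Separable : QClass → ExampleSet → Set
Separable 𝒬 E = Σ Query λ κ → (κ ∈Q 𝒬) × Separates κ E

-- Polynomials with natural-number coefficients, as coefficient lists
-- [a₀ , a₁ , …]  ↦  a₀ + a₁ x + a₂ x² + …
Poly : Set
Poly = List ℕ

evalPoly : Poly → ℕ → ℕ
evalPoly []       x = 0
evalPoly (a ∷ as) x = a + x * evalPoly as x

-- Entailment from a data instance is truth at time 0 in its canonical model, and the canonical models
-- of the examples in E are empty from time M = |E| on, so satisfaction in them is decidable and only
-- finitely many times matter.
--
-- Path queries: restricting every block of atoms to the atoms of one positive example D does not
-- change the meaning of a separator, which holds in D, and dropping trivial suffixes leaves one
-- modal step per block up to the last nontrivial one; evaluated in D, these steps advance strictly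
-- before time M, so the shrunk separator has size O(|D| · M).
--
-- Arbitrary queries: for every negative example N, follow a conjunct of κ that fails in N at 0 down
-- to an atom or a ◇ψ (up to ○^j). A failing ◇ψ means ψ fails at every later time of N; as N does not
-- change after M, this is witnessed by at most M conjuncts of ψ of the form ○^j A together with one
-- further ◇, treated recursively. Truth in a positive example bounds every ○^j A by M and makes the
-- nested ◇-levels advance in time, so the consequence of κ obtained for N has size O(M³), and the
-- conjunction over all N separates E.

module Submission where

open import Defs
open import Data.Nat using (ℕ; zero; suc; _+_; _*_; _∸_; _≤_; _<_; z≤n; s≤s; _≟_; >-nonZero)
open import Data.Nat.Properties
open import Data.Nat.Tactic.RingSolver using (solve-∀)
open import Data.Bool using (true; false)
open import Data.List using (List; []; _∷_; length; map; filter; _++_)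
open import Data.List.Relation.Unary.Any using (here; there)
open import Data.List.Membership.Propositional using (_∈_)
open import Data.List.Membership.Propositional.Properties using (∈-map⁺; ∈-filter⁺)
open import Data.List.Relation.Unary.All using (All; []; _∷_; lookup; tabulate)
import Data.List.Relation.Unary.All as All
open import Data.List.Relation.Unary.All.Properties using (all-filter; ++⁺; ++⁻ˡ; ++⁻ʳ)
open import Data.List.Properties using (length-map; length-filter)
open import Data.Nat.ListAction using (sum)
open import Data.Product using (Σ; _×_; _,_; proj₁; proj₂; ∃)
open import Data.Product.Properties using (≡-dec)
open import Data.List.Membership.DecPropositional {A = Fact} (≡-dec _≟_ _≟_) using (_∈?_)
open import Data.List.Membership.DecPropositional _≟_ using () renaming (_∈?_ to _∈ᴬ?_)
open import Data.Sum using (_⊎_; inj₁; inj₂)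
open import Data.Unit using (tt)
open import Data.Empty using (⊥-elim)
open import Relation.Nullary using (¬_; Dec; yes; no; does; contradiction; _×-dec_)
open import Relation.Nullary.Decidable using (dec-true; dec-false; map′)
open import Relation.Binary.PropositionalEquality
open import Function using (_∘_)

infix 4 _⇒_ _⊆ᴵ_

_⇒_ : Query → Query → Set
φ ⇒ ψ = ∀ I n → I , n ⊨ φ → I , n ⊨ ψ

_⊆ᴵ_ : Interp → Interp → Set
J ⊆ᴵ I = ∀ A t → J A t ≡ true → I A t ≡ true

⊨-mono : ∀ {I J} → J ⊆ᴵ I → ∀ φ n → J , n ⊨ φ → I , n ⊨ φ
⊨-mono J⊆I (atom A)  n p             = J⊆I A n p
⊨-mono J⊆I ⊤q        n p             = tt
⊨-mono J⊆I ⊥q        n ()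
⊨-mono J⊆I (φ ∧q ψ)  n (p , q)       = ⊨-mono J⊆I φ n p , ⊨-mono J⊆I ψ n q
⊨-mono J⊆I (○q φ)    n p             = ⊨-mono J⊆I φ (suc n) p
⊨-mono J⊆I (◇q φ)    n (m , n<m , p) = m , n<m , ⊨-mono J⊆I φ m p

canonical : DataInstance → Interp
canonical D A t = does ((A , t) ∈? D)

canonical-sound : ∀ {D A t} → canonical D A t ≡ true → (A , t) ∈ D
canonical-sound {D} {A} {t} e with (A , t) ∈? D
... | yes p = p
... | no _  = contradiction e λ ()

canonical-models : ∀ D → canonical D Models D
canonical-models D A ℓ = dec-true ((A , ℓ) ∈? D)

⊨₀⇒canonical : ∀ {D} κ → D ⊨₀ κ → canonical D , 0 ⊨ κ
⊨₀⇒canonical {D} κ h = h (canonical D) (canonical-models D)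

canonical⇒⊨₀ : ∀ {D} κ → canonical D , 0 ⊨ κ → D ⊨₀ κ
canonical⇒⊨₀ κ h I I⊨D = ⊨-mono (λ A t e → I⊨D A t (canonical-sound e)) κ 0 h

Bounded : ℕ → Interp → Set
Bounded M I = ∀ A t → M ≤ t → I A t ≡ false

module BoundedSemantics {M I} (bounded : Bounded M I) where

  ⊨-beyond : ∀ φ {t t′} → M ≤ t → M ≤ t′ → I , t ⊨ φ → I , t′ ⊨ φ
  ⊨-beyond (atom A) {t} M≤t _ p = contradiction (trans (sym p) (bounded A t M≤t)) λ ()
  ⊨-beyond ⊤q       _   _    _  = tt
  ⊨-beyond (φ ∧q ψ) M≤t M≤t′ (p , q) = ⊨-beyond φ M≤t M≤t′ p , ⊨-beyond ψ M≤t M≤t′ q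
  ⊨-beyond (○q φ)   M≤t M≤t′ p = ⊨-beyond φ (m≤n⇒m≤1+n M≤t) (m≤n⇒m≤1+n M≤t′) p
  ⊨-beyond (◇q φ) {t′ = t′} M≤t M≤t′ (m , t<m , p) =
    suc t′ , ≤-refl , ⊨-beyond φ (≤-trans M≤t (<⇒≤ t<m)) (m≤n⇒m≤1+n M≤t′) p

  ◇-witness-below : ∀ φ {t} → I , t ⊨ ◇q φ → ∃ λ v → v < suc (M + suc t) × t < v × I , v ⊨ φ
  ◇-witness-below φ {t} (m , t<m , p) with m ≤? M + suc t
  ... | yes m≤u = m , s≤s m≤u , t<m , p
  ... | no m≰u  = M + suc t , ≤-refl , m≤n+m (suc t) M ,
                  ⊨-beyond φ (≤-trans (m≤m+n M (suc t)) (<⇒≤ (≰⇒> m≰u))) (m≤m+n M (suc t)) p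

  ⊨? : ∀ φ t → Dec (I , t ⊨ φ)
  ⊨? (atom A) t with I A t
  ... | true  = yes refl
  ... | false = no λ ()
  ⊨? ⊤q       t = yes tt
  ⊨? ⊥q       t = no λ ()
  ⊨? (φ ∧q ψ) t = ⊨? φ t ×-dec ⊨? ψ t
  ⊨? (○q φ)   t = ⊨? φ (suc t)
  ⊨? (◇q φ)   t = map′ (λ (m , _ , t<m , p) → m , t<m , p) (◇-witness-below φ)
                       (anyUpTo? (λ m → (t <? m) ×-dec ⊨? φ m) (suc (M + suc t)))

fact-time<instSize : ∀ {D A ℓ} → (A , ℓ) ∈ D → ℓ < instSize D
fact-time<instSize {(_ , ℓ) ∷ D} (here refl) = ≤-trans (n≤1+n (suc ℓ)) (m≤m+n (suc (suc ℓ)) (instSize D))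
fact-time<instSize {f ∷ D}       (there m)   = ≤-trans (fact-time<instSize m) (m≤n+m (instSize D) (factSize f))

instSize≤instsSize : ∀ {D Ds} → D ∈ Ds → instSize D ≤ instsSize Ds
instSize≤instsSize {D} {_ ∷ Ds} (here refl) = m≤n⇒m≤1+n (m≤m+n (instSize D) (instsSize Ds))
instSize≤instsSize {D} {D′ ∷ Ds} (there m)  =
  m≤n⇒m≤1+n (≤-trans (instSize≤instsSize m) (m≤n+m (instsSize Ds) (instSize D′)))

length≤instsSize : ∀ Ds → length Ds ≤ instsSize Ds
length≤instsSize []       = z≤n
length≤instsSize (D ∷ Ds) = s≤s (≤-trans (length≤instsSize Ds) (m≤n+m _ _))

length≤instSize : ∀ D → length D ≤ instSize D
length≤instSize []            = z≤n
length≤instSize ((_ , ℓ) ∷ D) = s≤s (≤-trans (length≤instSize D) (m≤n+m _ (suc ℓ)))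

canonical-bounded : ∀ {D M} → instSize D ≤ M → Bounded M (canonical D)
canonical-bounded {D} D≤M A t M≤t =
  dec-false ((A , t) ∈? D) λ m → <⇒≱ (≤-trans (fact-time<instSize m) D≤M) M≤t

pos-bounded : ∀ {E D} → D ∈ pos E → Bounded (exSize E) (canonical D)
pos-bounded {D = D} D∈E = canonical-bounded {D} (≤-trans (instSize≤instsSize D∈E) (m≤m+n _ _))

neg-bounded : ∀ {E D} → D ∈ neg E → Bounded (exSize E) (canonical D)
neg-bounded {E} {D} D∈E = canonical-bounded {D} (≤-trans (instSize≤instsSize D∈E) (m≤n+m _ (instsSize (pos E))))

○^ : ℕ → Query → Query
○^ zero    φ = φ
○^ (suc j) φ = ○^ j (○q φ)

size-○^ : ∀ j φ → size (○^ j φ) ≡ j + size φ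
size-○^ zero    φ = refl
size-○^ (suc j) φ = trans (size-○^ j (○q φ)) (+-suc j (size φ))

⊨○^⁺ : ∀ {I} j {n} φ → I , j + n ⊨ φ → I , n ⊨ ○^ j φ
⊨○^⁺ zero    φ p = p
⊨○^⁺ (suc j) φ p = ⊨○^⁺ j (○q φ) p

⊨○^⁻ : ∀ {I} j {n} φ → I , n ⊨ ○^ j φ → I , j + n ⊨ φ
⊨○^⁻ zero    φ p = p
⊨○^⁻ (suc j) φ p = ⊨○^⁻ j (○q φ) p

data ConjunctAt : Query → ℕ → Query → Set where
  conj-self : ∀ {φ} → ConjunctAt φ 0 φ
  conj-∧ˡ   : ∀ {φ ψ j χ} → ConjunctAt φ j χ → ConjunctAt (φ ∧q ψ) j χ
  conj-∧ʳ   : ∀ {φ ψ j χ} → ConjunctAt ψ j χ → ConjunctAt (φ ∧q ψ) j χ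
  conj-○    : ∀ {φ j χ} → ConjunctAt φ j χ → ConjunctAt (○q φ) (suc j) χ

conjunctAt-sound : ∀ {I φ j χ} → ConjunctAt φ j χ → ∀ n → I , n ⊨ φ → I , j + n ⊨ χ
conjunctAt-sound conj-self   n p       = p
conjunctAt-sound (conj-∧ˡ c) n (p , _) = conjunctAt-sound c n p
conjunctAt-sound (conj-∧ʳ c) n (_ , q) = conjunctAt-sound c n q
conjunctAt-sound {I} (conj-○ {j = j} {χ} c) n p =
  subst (λ k → I , k ⊨ χ) (+-suc j n) (conjunctAt-sound c (suc n) p)

conjunctAt-size : ∀ {φ j χ} → ConjunctAt φ j χ → size χ ≤ size φ
conjunctAt-size conj-self = ≤-refl
conjunctAt-size {φ ∧q ψ} (conj-∧ˡ c) = ≤-trans (conjunctAt-size c) (m≤n⇒m≤1+n (m≤m+n (size φ) (size ψ)))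
conjunctAt-size {φ ∧q ψ} (conj-∧ʳ c) = ≤-trans (conjunctAt-size c) (m≤n⇒m≤1+n (m≤n+m (size ψ) (size φ)))
conjunctAt-size (conj-○ c) = m≤n⇒m≤1+n (conjunctAt-size c)

conjunctAt-noNext : ∀ {φ j χ} → NoNext φ → ConjunctAt φ j χ → j ≡ 0 × NoNext χ
conjunctAt-noNext nφ        conj-self   = refl , nφ
conjunctAt-noNext (n-∧ nφ _) (conj-∧ˡ c) = conjunctAt-noNext nφ c
conjunctAt-noNext (n-∧ _ nψ) (conj-∧ʳ c) = conjunctAt-noNext nψ c

data Leaf : Query → Set where
  atom-leaf : ∀ A → Leaf (atom A)
  ⊥-leaf    : Leaf ⊥q
  ◇-leaf    : ∀ φ → Leaf (◇q φ)

refutedLeaf : ∀ {I} → (∀ φ t → Dec (I , t ⊨ φ)) → ∀ φ s → ¬ (I , s ⊨ φ) →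
              Σ ℕ λ j → Σ Query λ χ → ConjunctAt φ j χ × Leaf χ × ¬ (I , j + s ⊨ χ)
refutedLeaf ⊨? (atom A) s ¬p = 0 , atom A , conj-self , atom-leaf A , ¬p
refutedLeaf ⊨? ⊤q       s ¬p = contradiction tt ¬p
refutedLeaf ⊨? ⊥q       s ¬p = 0 , ⊥q , conj-self , ⊥-leaf , ¬p
refutedLeaf ⊨? (◇q φ)   s ¬p = 0 , ◇q φ , conj-self , ◇-leaf φ , ¬p
refutedLeaf ⊨? (φ ∧q ψ) s ¬p with ⊨? φ s
... | no ¬φ = let j , χ , c , l , ¬χ = refutedLeaf ⊨? φ s ¬φ in j , χ , conj-∧ˡ c , l , ¬χ
... | yes φ = let j , χ , c , l , ¬χ = refutedLeaf ⊨? ψ s (λ ψ → ¬p (φ , ψ)) in j , χ , conj-∧ʳ c , l , ¬χ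
refutedLeaf {I} ⊨? (○q φ) s ¬p =
  let j , χ , c , l , ¬χ = refutedLeaf ⊨? φ (suc s) ¬p
  in suc j , χ , conj-○ c , l , λ p → ¬χ (subst (λ k → I , k ⊨ χ) (sym (+-suc j s)) p)

conjunct-implied : ∀ {Y j χ χ′} → ConjunctAt Y j χ → χ ⇒ χ′ → Y ⇒ ○^ j χ′
conjunct-implied {j = j} c χ⇒χ′ I n p = ⊨○^⁺ j _ (χ⇒χ′ I (j + n) (conjunctAt-sound c n p))

conjunct-noNext : ∀ {Y j χ χ′} → ConjunctAt Y j χ → (NoNext χ → NoNext χ′) → NoNext Y → NoNext (○^ j χ′)
conjunct-noNext c f nY with conjunctAt-noNext nY c
... | refl , nχ = f nχ

bounded⇒< : ∀ {M I A t} → Bounded M I → I A t ≡ true → t < M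
bounded⇒< {M} {t = t} bounded e with t <? M
... | yes t<M = t<M
... | no  t≮M = contradiction (trans (sym e) (bounded _ t (≮⇒≥ t≮M))) λ ()

0<size : ∀ φ → 0 < size φ
0<size (atom _) = s≤s z≤n
0<size ⊤q       = s≤s z≤n
0<size ⊥q       = s≤s z≤n
0<size (_ ∧q _) = s≤s z≤n
0<size (○q _)   = s≤s z≤n
0<size (◇q _)   = s≤s z≤n

levelBudget : ℕ → ℕ
levelBudget M = suc (M * M)

diamond-budget : ∀ {M j w m s} → j + w < m → m ≤ M →
                 s ≤ M * suc (M ∸ m) + (M ∸ m) * levelBudget M → j + suc s ≤ (M ∸ w) * levelBudget M
diamond-budget {M} {j} {w} {m} {s} j+w<m m≤M s≤ = begin
  j + suc s                ≤⟨ +-monoʳ-≤ j (s≤s (≤-trans s≤ (+-monoˡ-≤ (d * K) (*-monoʳ-≤ M sd≤M)))) ⟩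
  j + (K + d * K)          ≤⟨ +-monoˡ-≤ (K + d * K) (m≤m*n j K) ⟩
  j * K + (K + d * K)      ≡⟨ collect j K d ⟩
  (suc j + d) * K          ≤⟨ *-monoˡ-≤ K gap ⟩
  (M ∸ w) * K              ∎
  where
  open ≤-Reasoning
  K = levelBudget M
  d = M ∸ m
  collect : ∀ j K d → j * K + (K + d * K) ≡ (suc j + d) * K
  collect = solve-∀
  gap : suc j + d ≤ M ∸ w
  gap = m+n≤o⇒m≤o∸n (suc j + d) (begin
    suc j + d + w    ≡⟨ cong (_+ w) (+-comm (suc j) d) ⟩
    d + suc j + w    ≡⟨ +-assoc d (suc j) w ⟩
    d + suc (j + w)  ≤⟨ +-monoʳ-≤ d j+w<m ⟩
    d + m            ≡⟨ m∸n+n≡m m≤M ⟩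
    M                ∎)
  sd≤M : suc d ≤ M
  sd≤M = ≤-trans (s≤s (m≤n+m d j)) (≤-trans gap (m∸n≤m M w))

module Refutation (M : ℕ) {I⁺ I⁻ : Interp} (I⁺-bounded : Bounded M I⁺) (I⁻-bounded : Bounded M I⁻) where
  open BoundedSemantics I⁻-bounded using (⊨?)

  K : ℕ
  K = levelBudget M

  RefutedFrom : ℕ → Query → Set
  RefutedFrom t φ = ∀ t′ → t ≤ t′ → ¬ (I⁻ , t′ ⊨ φ)

  Satisfiable : Query → Set
  Satisfiable φ = ∃ λ w → I⁺ , w ⊨ φ

  ◇-refutedFrom : ∀ {s} Z → ¬ (I⁻ , s ⊨ ◇q Z) → RefutedFrom (suc s) Z
  ◇-refutedFrom Z ¬◇Z t′ s<t′ z = ¬◇Z (t′ , s<t′ , z)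

  ◇-conjunct-satisfiable : ∀ {Y j Z w} → ConjunctAt Y j (◇q Z) → I⁺ , w ⊨ Y → Satisfiable Z
  ◇-conjunct-satisfiable {w = w} conj p = let m , _ , z = conjunctAt-sound conj w p in m , z

  -- If the refuting query holds in I⁺ at w, it has at most c atomic conjuncts ○^j A, each of size
  -- j + 1 ≤ M ∸ w, and one ◇-conjunct, whose body holds strictly later: the term (M ∸ w) * K pays
  -- for the whole nest of ◇-levels by induction on M ∸ w.
  record Refuter (Y : Query) (t c : ℕ) : Set where
    field
      query   : Query
      implied : Y ⇒ query
      refutes : RefutedFrom t query
      noNext  : NoNext Y → NoNext query
      small   : ∀ w → I⁺ , w ⊨ query → w < M × size query ≤ c * suc (M ∸ w) + (M ∸ w) * K

  atomPiece-small : ∀ j A {w} → I⁺ , w ⊨ ○^ j (atom A) → w < M × size (○^ j (atom A)) ≤ M ∸ w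
  atomPiece-small j A {w} p =
    ≤-<-trans (m≤n+m w j) j+w<M ,
    ≤-trans (≤-reflexive (trans (size-○^ j (atom A)) (+-comm j 1))) (m+n≤o⇒m≤o∸n (suc j) j+w<M)
    where
    j+w<M : j + w < M
    j+w<M = bounded⇒< I⁺-bounded (⊨○^⁻ j (atom A) p)

  atomRefuter : ∀ {Y j A t} → ConjunctAt Y j (atom A) → M ≤ t → Refuter Y t 0
  atomRefuter {j = j} {A} conj M≤t = record
    { query   = ○^ j (atom A)
    ; implied = conjunct-implied conj λ _ _ p → p
    ; refutes = λ t′ t≤t′ p →
        <⇒≱ (bounded⇒< I⁻-bounded (⊨○^⁻ j (atom A) p)) (≤-trans M≤t (≤-trans t≤t′ (m≤n+m t′ j)))
    ; noNext  = conjunct-noNext conj λ n → n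
    ; small   = λ w p → let w<M , size≤ = atomPiece-small j A p in
                        w<M , ≤-trans size≤ (m≤m*n (M ∸ w) K)
    }

  consAtom : ∀ {Y j A t c} → ConjunctAt Y j (atom A) → ¬ (I⁻ , j + t ⊨ atom A) →
             Refuter Y (suc t) c → Refuter Y t (suc c)
  consAtom {j = j} {A} {t} {c} conj ¬A R = record
    { query   = ○^ j (atom A) ∧q R.query
    ; implied = λ I n p → conjunct-implied conj (λ _ _ q → q) I n p , R.implied I n p
    ; refutes = refutes
    ; noNext  = λ nY → n-∧ (conjunct-noNext conj (λ n → n) nY) (R.noNext nY)
    ; small   = λ w (a , r) → let w<M , size≤ = R.small w r in
        w<M , ≤-trans (+-mono-≤ (s≤s (proj₂ (atomPiece-small j A a))) size≤)
                      (≤-reflexive (sym (+-assoc (suc (M ∸ w)) (c * suc (M ∸ w)) ((M ∸ w) * K))))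
    }
    where
    module R = Refuter R
    refutes : RefutedFrom t (○^ j (atom A) ∧q R.query)
    refutes t′ t≤t′ (a , r) with m≤n⇒m<n∨m≡n t≤t′
    ... | inj₁ t<t′ = R.refutes t′ t<t′ r
    ... | inj₂ refl = ¬A (⊨○^⁻ j (atom A) a)

  diamondRefuter : ∀ {Y j Z t} c → ConjunctAt Y j (◇q Z) → Refuter Z (suc (j + t)) M → Refuter Y t c
  diamondRefuter {j = j} {Z} {t} c conj R = record
    { query   = ○^ j (◇q R.query)
    ; implied = conjunct-implied conj λ I n (m , n<m , z) → m , n<m , R.implied I m z
    ; refutes = λ t′ t≤t′ p → let m , j+t′<m , r = ⊨○^⁻ j (◇q R.query) p in
                R.refutes m (≤-trans (s≤s (+-monoʳ-≤ j t≤t′)) j+t′<m) r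
    ; noNext  = conjunct-noNext conj λ { (n-◇ nZ) → n-◇ (R.noNext nZ) }
    ; small   = λ w p → let m , j+w<m , r = ⊨○^⁻ j (◇q R.query) p
                            m<M , size≤ = R.small m r in
        ≤-<-trans (m≤n+m w j) (<-trans j+w<m m<M) ,
        ≤-trans (≤-reflexive (size-○^ j (◇q R.query)))
                (≤-trans (diamond-budget j+w<m (<⇒≤ m<M) size≤) (m≤n+m _ (c * suc (M ∸ w))))
    }
    where module R = Refuter R

  mutual
    refuter : ∀ n {Y} → size Y ≤ n → ∀ t → RefutedFrom t Y → Satisfiable Y → Refuter Y t M
    refuter zero    {Y} size≤ _ _   _   = contradiction size≤ (<⇒≱ (0<size Y))
    refuter (suc n) size≤ t ref sat = iterate n size≤ ref sat M t ≤-refl (m≤m+n M t)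

    -- Conjuncts refuted at t, t+1, … are collected; an atomic one is refuted for good once t ≥ M,
    -- a ◇-conjunct refuted at t is refuted at every later time.
    iterate : ∀ n {Y t₀} → size Y ≤ suc n → RefutedFrom t₀ Y → Satisfiable Y →
              ∀ c t → t₀ ≤ t → M ≤ c + t → Refuter Y t c
    iterate n {Y} size≤ ref sat c t t₀≤t M≤c+t with refutedLeaf ⊨? Y t (ref t t₀≤t)
    iterate n size≤ ref (w , p) c t _ _ | j , ⊥q , conj , ⊥-leaf , _ =
      ⊥-elim (conjunctAt-sound conj w p)
    iterate n size≤ ref (w , p) c t _ _ | j , ◇q Z , conj , ◇-leaf Z , ¬◇Z =
      diamondRefuter c conj
        (refuter n (≤-pred (≤-trans (conjunctAt-size conj) size≤)) (suc (j + t))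
                 (◇-refutedFrom Z ¬◇Z) (◇-conjunct-satisfiable conj p))
    iterate n size≤ ref sat zero t _ M≤t | j , atom A , conj , atom-leaf A , _ =
      atomRefuter conj M≤t
    iterate n size≤ ref sat (suc c) t t₀≤t M≤c+t | j , atom A , conj , atom-leaf A , ¬A =
      consAtom conj ¬A
        (iterate n size≤ ref sat c (suc t) (m≤n⇒m≤1+n t₀≤t) (≤-trans M≤c+t (≤-reflexive (sym (+-suc c t)))))

  record Certificate (κ : Query) : Set where
    field
      query   : Query
      implied : κ ⇒ query
      refutes : ¬ (I⁻ , 0 ⊨ query)
      noNext  : NoNext κ → NoNext query
      size≤   : size query ≤ M * K

  certificate : ∀ {κ} → I⁺ , 0 ⊨ κ → ¬ (I⁻ , 0 ⊨ κ) → Certificate κ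
  certificate {κ} p ¬p with refutedLeaf ⊨? κ 0 ¬p
  ... | j , ⊥q , conj , ⊥-leaf , _ = ⊥-elim (conjunctAt-sound conj 0 p)
  ... | j , atom A , conj , atom-leaf A , ¬A = record
    { query   = ○^ j (atom A)
    ; implied = conjunct-implied conj λ _ _ q → q
    ; refutes = λ q → ¬A (⊨○^⁻ j (atom A) q)
    ; noNext  = conjunct-noNext conj λ n → n
    ; size≤   = ≤-trans (proj₂ (atomPiece-small j A (conjunct-implied conj (λ _ _ q → q) I⁺ 0 p))) (m≤m*n M K)
    }
  ... | j , ◇q Z , conj , ◇-leaf Z , ¬◇Z = record
    { query   = R.query
    ; implied = R.implied
    ; refutes = R.refutes 0 z≤n
    ; noNext  = R.noNext
    ; size≤   = proj₂ (R.small 0 (R.implied I⁺ 0 p))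
    }
    where
    module R = Refuter (diamondRefuter 0 conj
      (refuter (size Z) ≤-refl (suc (j + 0)) (◇-refutedFrom Z ¬◇Z) (◇-conjunct-satisfiable conj p)))

refuteNegatives : ∀ {M κ I⁺} → Bounded M I⁺ → I⁺ , 0 ⊨ κ → ∀ negs →
            (∀ {N} → N ∈ negs → Bounded M (canonical N)) → (∀ {N} → N ∈ negs → ¬ (canonical N , 0 ⊨ κ)) →
            Σ Query λ κ′ → κ ⇒ κ′ × (∀ {N} → N ∈ negs → ¬ (canonical N , 0 ⊨ κ′)) ×
              (NoNext κ → NoNext κ′) × size κ′ ≤ length negs * suc (M * levelBudget M) + 1
refuteNegatives _ _ [] _ _ = ⊤q , (λ _ _ _ → tt) , (λ ()) , (λ _ → n-⊤) , ≤-refl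
refuteNegatives {M} {κ} I⁺-bounded p (N ∷ negs) bounded refuted =
  let κ″ , implied , refutes , noNext , size≤ =
        refuteNegatives I⁺-bounded p negs (bounded ∘ there) (refuted ∘ there)
  in C.query ∧q κ″ ,
     (λ I n q → C.implied I n q , implied I n q) ,
     (λ { (here refl) (c , _) → C.refutes c ; (there N∈negs) (_ , r) → refutes N∈negs r }) ,
     (λ nκ → n-∧ (C.noNext nκ) (noNext nκ)) ,
     ≤-trans (s≤s (+-mono-≤ C.size≤ size≤))
             (≤-reflexive (sym (+-assoc (suc (M * levelBudget M)) (length negs * suc (M * levelBudget M)) 1)))
  where
  module Ref = Refutation M I⁺-bounded (bounded (here refl))
  module C = Ref.Certificate (Ref.certificate {κ} p (refuted (here refl)))

data Modality : Set where
  next eventually : Modality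

modal : Modality → Query → Query
modal next       = ○q
modal eventually = ◇q

size-modal : ∀ o q → size (modal o q) ≡ suc (size q)
size-modal next       q = refl
size-modal eventually q = refl

modal-later : ∀ o {I n q} → I , n ⊨ modal o q → ∃ λ v → n < v × I , v ⊨ q
modal-later next       p = _ , ≤-refl , p
modal-later eventually p = p

modal-mono : ∀ o {q q′} → q ⇒ q′ → modal o q ⇒ modal o q′
modal-mono next       q⇒q′ I n p              = q⇒q′ I (suc n) p
modal-mono eventually q⇒q′ I n (m , n<m , p) = m , n<m , q⇒q′ I m p

modal-⊤ : ∀ o {I n} → I , n ⊨ modal o ⊤q
modal-⊤ next       = tt
modal-⊤ eventually = _ , ≤-refl , tt

-- A trivial suffix is dropped: it has no witness in D before M, so its modal step could not be paid for.
glue : Query → Modality → Query → Query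
glue ρ o ⊤q = ρ
glue ρ o q  = ρ ∧q modal o q

data GlueView (ρ : Query) (o : Modality) : Query → Set where
  trivial : GlueView ρ o ⊤q
  proper  : ∀ {q} → q ≢ ⊤q → glue ρ o q ≡ ρ ∧q modal o q → GlueView ρ o q

glueView : ∀ ρ o q → GlueView ρ o q
glueView ρ o (atom _) = proper (λ ()) refl
glueView ρ o ⊤q       = trivial
glueView ρ o ⊥q       = proper (λ ()) refl
glueView ρ o (_ ∧q _) = proper (λ ()) refl
glueView ρ o (○q _)   = proper (λ ()) refl
glueView ρ o (◇q _)   = proper (λ ()) refl

⇒glue : ∀ {ρ ρ′ q q′} o → ρ ⇒ ρ′ → q ⇒ q′ → ρ ∧q modal o q ⇒ glue ρ′ o q′
⇒glue {ρ′ = ρ′} {q′ = q′} o ρ⇒ρ′ q⇒q′ I n (r , p) with glueView ρ′ o q′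
... | trivial        = ρ⇒ρ′ I n r
... | proper _ glued = subst (I , n ⊨_) (sym glued) (ρ⇒ρ′ I n r , modal-mono o q⇒q′ I n p)

glue⇒ : ∀ {ρ ρ′ q q′} o → ρ′ ⇒ ρ → q′ ⇒ q → glue ρ′ o q′ ⇒ ρ ∧q modal o q
glue⇒ {ρ′ = ρ′} {q′ = q′} o ρ′⇒ρ q′⇒q I n p with glueView ρ′ o q′
... | trivial        = ρ′⇒ρ I n p , modal-mono o q′⇒q I n (modal-⊤ o)
... | proper _ glued = let r , p′ = subst (I , n ⊨_) glued p in ρ′⇒ρ I n r , modal-mono o q′⇒q I n p′

pathStep : ∀ o {ρ q} → IsConjAtoms ρ → IsPathNextDia q → IsPathNextDia (ρ ∧q modal o q)
pathStep next       = p-○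
pathStep eventually = p-◇

glue-pathNextDia : ∀ {ρ q} o → IsConjAtoms ρ → IsPathNextDia q → IsPathNextDia (glue ρ o q)
glue-pathNextDia {ρ} {q} o c p with glueView ρ o q
... | trivial        = p-end c
... | proper _ glued = subst IsPathNextDia (sym glued) (pathStep o c p)

glue-pathDia : ∀ {ρ q} → IsConjAtoms ρ → IsPathDia q → IsPathDia (glue ρ eventually q)
glue-pathDia {ρ} {q} c p with glueView ρ eventually q
... | trivial        = p-end c
... | proper _ glued = subst IsPathDia (sym glued) (p-◇ c p)

toPathNextDia : ∀ {κ} → IsPathDia κ → IsPathNextDia κ
toPathNextDia (p-end c) = p-end c
toPathNextDia (p-◇ c p) = p-◇ c (toPathNextDia p)

atomsOf : Query → List Atom
atomsOf (atom A) = A ∷ []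
atomsOf (φ ∧q ψ) = atomsOf φ ++ atomsOf ψ
atomsOf _        = []

HoldsAt : Interp → ℕ → Atom → Set
HoldsAt I n A = I A n ≡ true

⊨conjAtoms⁻ : ∀ {I n ρ} → IsConjAtoms ρ → I , n ⊨ ρ → All (HoldsAt I n) (atomsOf ρ)
⊨conjAtoms⁻ c-⊤        _       = []
⊨conjAtoms⁻ (c-atom A) p       = p ∷ []
⊨conjAtoms⁻ (c-∧ c d)  (p , q) = ++⁺ (⊨conjAtoms⁻ c p) (⊨conjAtoms⁻ d q)

⊨conjAtoms⁺ : ∀ {I n ρ} → IsConjAtoms ρ → All (HoldsAt I n) (atomsOf ρ) → I , n ⊨ ρ
⊨conjAtoms⁺ c-⊤              _         = tt
⊨conjAtoms⁺ (c-atom A)       (p ∷ [])  = p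
⊨conjAtoms⁺ (c-∧ {φ} c d)    ps        = ⊨conjAtoms⁺ c (++⁻ˡ (atomsOf φ) ps) , ⊨conjAtoms⁺ d (++⁻ʳ (atomsOf φ) ps)

conjunction : List Atom → Query
conjunction []       = ⊤q
conjunction (A ∷ As) = atom A ∧q conjunction As

⊨conjunction⁻ : ∀ {I n} As → I , n ⊨ conjunction As → All (HoldsAt I n) As
⊨conjunction⁻ []       _       = []
⊨conjunction⁻ (A ∷ As) (p , q) = p ∷ ⊨conjunction⁻ As q

⊨conjunction⁺ : ∀ {I n} As → All (HoldsAt I n) As → I , n ⊨ conjunction As
⊨conjunction⁺ []       []       = tt
⊨conjunction⁺ (A ∷ As) (p ∷ ps) = p , ⊨conjunction⁺ As ps

conjunction-conjAtoms : ∀ As → IsConjAtoms (conjunction As)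
conjunction-conjAtoms []       = c-⊤
conjunction-conjAtoms (A ∷ As) = c-∧ (c-atom A) (conjunction-conjAtoms As)

size-conjunction : ∀ As → size (conjunction As) ≡ suc (2 * length As)
size-conjunction []       = refl
size-conjunction (A ∷ As) = cong (suc ∘ suc) (trans (size-conjunction As) (sym (+-suc (length As) (length As + 0))))

module Path (D : DataInstance) where

  restrict : Query → Query
  restrict ρ = conjunction (filter (_∈ᴬ? atomsOf ρ) (map proj₁ D))

  ⇒restrict : ∀ {ρ} → IsConjAtoms ρ → ρ ⇒ restrict ρ
  ⇒restrict {ρ} c I n p =
    ⊨conjunction⁺ _ (All.map (lookup (⊨conjAtoms⁻ c p)) (all-filter (_∈ᴬ? atomsOf ρ) (map proj₁ D)))

  restrict⇒ : ∀ {ρ w} → IsConjAtoms ρ → canonical D , w ⊨ ρ → restrict ρ ⇒ ρ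
  restrict⇒ {ρ} c p I n q = ⊨conjAtoms⁺ c (tabulate λ A∈ρ →
    lookup (⊨conjunction⁻ _ q)
           (∈-filter⁺ (_∈ᴬ? atomsOf ρ) (∈-map⁺ proj₁ (canonical-sound {D} (lookup (⊨conjAtoms⁻ c p) A∈ρ))) A∈ρ))

  length-restrict : ∀ ρ → length (filter (_∈ᴬ? atomsOf ρ) (map proj₁ D)) ≤ length D
  length-restrict ρ = ≤-trans (length-filter (_∈ᴬ? atomsOf ρ) (map proj₁ D)) (≤-reflexive (length-map proj₁ D))

  shrink : ∀ {κ} → IsPathNextDia κ → Query
  shrink (p-end {ρ} _)   = restrict ρ
  shrink (p-○ {ρ} _ p)   = glue (restrict ρ) next (shrink p)
  shrink (p-◇ {ρ} _ p)   = glue (restrict ρ) eventually (shrink p)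

  ⇒shrink : ∀ {κ} (p : IsPathNextDia κ) → κ ⇒ shrink p
  ⇒shrink (p-end c) = ⇒restrict c
  ⇒shrink (p-○ {ρ} {q} c p) = ⇒glue {ρ} {restrict ρ} {q} {shrink p} next (⇒restrict c) (⇒shrink p)
  ⇒shrink (p-◇ {ρ} {q} c p) = ⇒glue {ρ} {restrict ρ} {q} {shrink p} eventually (⇒restrict c) (⇒shrink p)

  shrink⇒ : ∀ {κ w} (p : IsPathNextDia κ) → canonical D , w ⊨ κ → shrink p ⇒ κ
  shrink⇒ (p-end c) r = restrict⇒ c r
  shrink⇒ (p-○ {ρ} {q} c p) (r , s) =
    glue⇒ {ρ} {restrict ρ} {q} {shrink p} next (restrict⇒ c r) (shrink⇒ p s)
  shrink⇒ (p-◇ {ρ} {q} c p) (r , (_ , _ , s)) =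
    glue⇒ {ρ} {restrict ρ} {q} {shrink p} eventually (restrict⇒ c r) (shrink⇒ p s)

  shrink-pathNextDia : ∀ {κ} (p : IsPathNextDia κ) → IsPathNextDia (shrink p)
  shrink-pathNextDia (p-end {ρ} _) = p-end (conjunction-conjAtoms _)
  shrink-pathNextDia (p-○ _ p)     = glue-pathNextDia next (conjunction-conjAtoms _) (shrink-pathNextDia p)
  shrink-pathNextDia (p-◇ _ p)     = glue-pathNextDia eventually (conjunction-conjAtoms _) (shrink-pathNextDia p)

  restrict-size : ∀ ρ → size (restrict ρ) ≤ suc (2 * length D)
  restrict-size ρ = ≤-trans (≤-reflexive (size-conjunction _)) (s≤s (*-monoʳ-≤ 2 (length-restrict ρ)))

  width : ℕ
  width = suc (suc (suc (2 * length D)))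

  module _ {M} (D-bounded : Bounded M (canonical D)) where

    Short : Query → ℕ → Set
    Short q w = q ≡ ⊤q ⊎ (w < M × size q ≤ width * (M ∸ w))

    restrict-short : ∀ ρ {w} → canonical D , w ⊨ restrict ρ → Short (restrict ρ) w
    restrict-short ρ {w} p with filter (_∈ᴬ? atomsOf ρ) (map proj₁ D) | restrict-size ρ
    ... | []     | _      = inj₁ refl
    ... | A ∷ As | size≤ =
      inj₂ (w<M , ≤-trans (m≤n⇒m≤1+n (m≤n⇒m≤1+n size≤)) (m≤m*n width (M ∸ w) {{>-nonZero (m<n⇒0<n∸m w<M)}}))
      where w<M = bounded⇒< D-bounded (proj₁ p)

    glue-short : ∀ ρ o q {w} → size ρ ≤ suc (2 * length D) → (canonical D , w ⊨ ρ → Short ρ w) →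
                 (∀ {v} → canonical D , v ⊨ q → Short q v) → canonical D , w ⊨ glue ρ o q → Short (glue ρ o q) w
    glue-short ρ o q {w} ρ-size ρ-short q-short p with glueView ρ o q
    ... | trivial = ρ-short p
    ... | proper q≢⊤ glued with modal-later o (proj₂ (subst (canonical D , w ⊨_) glued p))
    ...   | v , w<v , qv with q-short qv
    ...     | inj₁ q≡⊤            = contradiction q≡⊤ q≢⊤
    ...     | inj₂ (v<M , q-size) = inj₂ (<-trans w<v v<M , subst (λ φ → size φ ≤ width * (M ∸ w)) (sym glued) (begin
      suc (size ρ + size (modal o q))  ≡⟨ cong (λ k → suc (size ρ + k)) (size-modal o q) ⟩
      suc (size ρ + suc (size q))      ≡⟨ cong suc (+-suc (size ρ) (size q)) ⟩
      suc (suc (size ρ)) + size q      ≤⟨ +-mono-≤ (s≤s (s≤s ρ-size)) q-size ⟩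
      width + width * (M ∸ v)          ≡⟨ sym (*-suc width (M ∸ v)) ⟩
      width * suc (M ∸ v)              ≤⟨ *-monoʳ-≤ width (∸-monoʳ-< w<v (<⇒≤ v<M)) ⟩
      width * (M ∸ w)                  ∎))
      where open ≤-Reasoning

    shrink-short : ∀ {κ w} (p : IsPathNextDia κ) → canonical D , w ⊨ shrink p → Short (shrink p) w
    shrink-short (p-end {ρ} _)   = restrict-short ρ
    shrink-short (p-○ {ρ} _ p)   =
      glue-short (restrict ρ) next (shrink p) (restrict-size ρ) (restrict-short ρ) (shrink-short p)
    shrink-short (p-◇ {ρ} _ p)   =
      glue-short (restrict ρ) eventually (shrink p) (restrict-size ρ) (restrict-short ρ) (shrink-short p)

  shrink-pathDia : ∀ {κ} → IsPathDia κ → (p : IsPathNextDia κ) → IsPathDia (shrink p)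
  shrink-pathDia (p-end _)   (p-end _)   = p-end (conjunction-conjAtoms _)
  shrink-pathDia (p-◇ _ p)   (p-◇ _ p′)  = glue-pathDia (conjunction-conjAtoms _) (shrink-pathDia p p′)
  shrink-pathDia (p-end (c-∧ _ ())) (p-○ _ _)
  shrink-pathDia (p-end (c-∧ _ ())) (p-◇ _ _)
  shrink-pathDia (p-◇ _ _)   (p-end (c-∧ _ ()))

∈⇒≤sum : ∀ {n ns} → n ∈ ns → n ≤ sum ns
∈⇒≤sum {ns = n ∷ ns} (here refl)  = m≤m+n n (sum ns)
∈⇒≤sum {ns = m ∷ ns} (there n∈ns) = ≤-trans (∈⇒≤sum n∈ns) (m≤n+m (sum ns) m)

freshAtom : List DataInstance → Atom
freshAtom negs = suc (sum (map (sum ∘ map proj₁) negs))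

freshAtom-separates : ∀ negs → Separates (atom (freshAtom negs)) ⟨ [] , negs ⟩
freshAtom-separates negs = (λ _ ()) , λ N N∈negs N⊨A →
  let A∈N = canonical-sound {N} (⊨₀⇒canonical {N} (atom (freshAtom negs)) N⊨A)
  in <-irrefl refl (≤-trans (∈⇒≤sum (∈-map⁺ proj₁ A∈N)) (∈⇒≤sum (∈-map⁺ (sum ∘ map proj₁) N∈negs)))

pathPoly : Poly
pathPoly = 1 ∷ 3 ∷ 2 ∷ []

generalPoly : Poly
generalPoly = 1 ∷ 1 ∷ 1 ∷ 0 ∷ 1 ∷ []

pathPoly-eval : ∀ x → suc (suc (suc (suc (2 * x))) * x) ≡ 1 + x * (3 + x * (2 + x * 0))
pathPoly-eval = solve-∀

generalPoly-eval : ∀ x → x * suc (x * suc (x * x)) + 1 ≡ 1 + x * (1 + x * (1 + x * (0 + x * (1 + x * 0))))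
generalPoly-eval = solve-∀

pathSeparator : ∀ E {κ} → IsPathNextDia κ → Separates κ E →
                Σ Query λ κ′ → IsPathNextDia κ′ × (IsPathDia κ → IsPathDia κ′) × Separates κ′ E ×
                  size κ′ ≤ evalPoly pathPoly (exSize E)
pathSeparator ⟨ [] , negs ⟩ _ _ =
  atom (freshAtom negs) , p-end (c-atom _) , (λ _ → p-end (c-atom _)) , freshAtom-separates negs , s≤s z≤n
pathSeparator E@(⟨ D ∷ _ , _ ⟩) {κ} p (positive , negative) =
  shrink p , shrink-pathNextDia p , (λ pd → shrink-pathDia pd p) ,
  ((λ D′ D′∈E I I⊨D′ → ⇒shrink p I 0 (positive D′ D′∈E I I⊨D′)) ,
   (λ N N∈E N⊨κ′ → negative N N∈E λ I I⊨N → shrink⇒ p D⊨κ I 0 (N⊨κ′ I I⊨N))) ,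
  ≤-trans (short⇒size (shrink-short (pos-bounded {E} (here refl)) p (⇒shrink p (canonical D) 0 D⊨κ)))
          (≤-reflexive (pathPoly-eval M))
  where
  open Path D
  M = exSize E
  D⊨κ : canonical D , 0 ⊨ κ
  D⊨κ = ⊨₀⇒canonical κ (positive D (here refl))
  width≤ : width ≤ suc (suc (suc (2 * M)))
  width≤ = s≤s (s≤s (s≤s (*-monoʳ-≤ 2
             (≤-trans (length≤instSize D) (≤-trans (instSize≤instsSize {Ds = pos E} (here refl)) (m≤m+n _ _))))))
  short⇒size : Short (pos-bounded {E} (here refl)) (shrink p) 0 → size (shrink p) ≤ suc (suc (suc (suc (2 * M))) * M)
  short⇒size (inj₁ shrink≡⊤)   = ≤-trans (≤-reflexive (cong size shrink≡⊤)) (s≤s z≤n)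
  short⇒size (inj₂ (_ , size≤)) = m≤n⇒m≤1+n (≤-trans size≤ (*-monoˡ-≤ M width≤))

generalSeparator : ∀ E {κ} → Separates κ E →
                   Σ Query λ κ′ → (NoNext κ → NoNext κ′) × Separates κ′ E × size κ′ ≤ evalPoly generalPoly (exSize E)
generalSeparator ⟨ [] , negs ⟩ _ =
  atom (freshAtom negs) , (λ _ → n-atom _) , freshAtom-separates negs , s≤s z≤n
generalSeparator E@(⟨ D ∷ _ , _ ⟩) {κ} (positive , negative) =
  let κ′ , implied , refutes , noNext , size≤ =
        refuteNegatives (pos-bounded {E} (here refl)) (⊨₀⇒canonical κ (positive D (here refl))) (neg E)
                  (neg-bounded {E}) (λ N∈E → negative _ N∈E ∘ canonical⇒⊨₀ κ)
  in κ′ , noNext ,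
     ((λ D′ D′∈E I I⊨D′ → implied I 0 (positive D′ D′∈E I I⊨D′)) ,
      (λ N N∈E → refutes N∈E ∘ ⊨₀⇒canonical κ′)) ,
     ≤-trans size≤ (≤-trans (+-monoˡ-≤ 1 (*-monoˡ-≤ (suc (M * levelBudget M)) #neg≤M))
                            (≤-reflexive (generalPoly-eval M)))
  where
  M = exSize E
  #neg≤M : length (neg E) ≤ M
  #neg≤M = ≤-trans (length≤instsSize (neg E)) (m≤n+m _ (instsSize (pos E)))

lemma2 : (𝒬 : QClass) →
    Σ Poly λ p → (E : ExampleSet) → Separable 𝒬 E →
      Σ Query λ κ → (κ ∈Q 𝒬) × Separates κ E × (size κ ≤ evalPoly p (exSize E))
lemma2 Qp-◇ = pathPoly , λ E (κ , pd , sep) →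
  let κ′ , _ , pd′ , sep′ , size≤ = pathSeparator E (toPathNextDia pd) sep in κ′ , pd′ pd , sep′ , size≤
lemma2 Qp-○◇ = pathPoly , λ E (κ , pnd , sep) →
  let κ′ , pnd′ , _ , sep′ , size≤ = pathSeparator E pnd sep in κ′ , pnd′ , sep′ , size≤
lemma2 Q-◇ = generalPoly , λ E (κ , nn , sep) →
  let κ′ , nn′ , sep′ , size≤ = generalSeparator E {κ} sep in κ′ , nn′ nn , sep′ , size≤
lemma2 Q-○◇ = generalPoly , λ E (κ , _ , sep) →
  let κ′ , _ , sep′ , size≤ = generalSeparator E {κ} sep in κ′ , tt , sep′ , size≤
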